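{- Let $G$ and $H$ be loop-free, finite, connected, directed graphs, each with at least two vertices. There exists a graph homomorphism $\phi\colon G\to H$ if and only if there exists an algebra homomorphism $\psi\colon G^{\dagger}\to H^{\dagger}$.
   Context: A homomorphism of directed graphs $\phi\colon G=(V_G,E_G)\to H=(V_H,E_H)$ is a map $V_G\to V_H$ such that $(u,v)\in E_G$ implies $(\phi(u),\phi(v))\in E_H$. For a directed graph $G=(V_G,E_G)$, the algebra $G^{\dagger}$ has two unary operations $f,g$ and universe consisting of pairwise distinct elements $v_1,v_2$ for each $v\in V_G$ and $a_{(u,v)},b_{(u,v)}$ for each edge $(u,v)\in E_G$. The operations are: $f(u_1)=u_1$, $g(u_1)=u_2$; $f(u_2)=u_1$, $g(u_2)=u_2$; $f(a_{(u,v)})=u_1$, $g(a_{(u,v)})=b_{(u,v)}$; $f(b_{(u,v)})=v_2$, $g(b_{(u,v)})=a_{(u,v)}$. An algebra homomorphism is a map commuting with both $f$ and $g$. -}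

module Defs where

open import Data.Nat using (ℕ; _≤_)
open import Data.Fin using (Fin)
open import Data.Bool using (Bool; true; false; T)
open import Data.Product using (Σ; _×_; _,_)
open import Relation.Binary.PropositionalEquality using (_≡_)
open import Relation.Nullary using (¬_)

record DiGraph : Set where
  constructor digraph
  field
    n    : ℕ
    edge : Fin n → Fin n → Bool

open DiGraph public

Edge : (G : DiGraph) → Fin (n G) → Fin (n G) → Set
Edge G u v = T (edge G u v)

LoopFree : DiGraph → Set
LoopFree G = ∀ (v : Fin (n G)) → ¬ Edge G v v

-- Connectedness of a directed graph = connectedness of the underlying
-- undirected graph (weak connectivity): walks that may use edges in
-- either direction.
data UWalk (G : DiGraph) : Fin (n G) → Fin (n G) → Set where
  here : ∀ {u} → UWalk G u u
  fwd  : ∀ {u v w} → Edge G u v → UWalk G v w → UWalk G u w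
  bwd  : ∀ {u v w} → Edge G v u → UWalk G v w → UWalk G u w

Connected : DiGraph → Set
Connected G = ∀ (u v : Fin (n G)) → UWalk G u v

AtLeastTwoVertices : DiGraph → Set
AtLeastTwoVertices G = 2 ≤ n G

IsGraphHom : (G H : DiGraph) → (Fin (n G) → Fin (n H)) → Set
IsGraphHom G H φ = ∀ (u v : Fin (n G)) → Edge G u v → Edge H (φ u) (φ v)

GraphHom : DiGraph → DiGraph → Set
GraphHom G H = Σ (Fin (n G) → Fin (n H)) (IsGraphHom G H)

record UnaryAlg2 : Set₁ where
  field
    Carrier : Set
    f g     : Carrier → Carrier

open UnaryAlg2 public

IsAlgHom : (A B : UnaryAlg2) → (Carrier A → Carrier B) → Set
IsAlgHom A B ψ = (∀ x → ψ (f A x) ≡ f B (ψ x)) × (∀ x → ψ (g A x) ≡ g B (ψ x))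

AlgHom : UnaryAlg2 → UnaryAlg2 → Set
AlgHom A B = Σ (Carrier A → Carrier B) (IsAlgHom A B)

-- Universe of G†: pairwise distinct elements v₁, v₂ (v ∈ V_G) and
-- a_(u,v), b_(u,v) ((u,v) ∈ E_G).
data DagElem (G : DiGraph) : Set where
  vtx₁ vtx₂ : Fin (n G) → DagElem G
  aE bE     : (u v : Fin (n G)) → Edge G u v → DagElem G

dag-f : (G : DiGraph) → DagElem G → DagElem G
dag-f G (vtx₁ u)     = vtx₁ u
dag-f G (vtx₂ u)     = vtx₁ u
dag-f G (aE u v e)   = vtx₁ u
dag-f G (bE u v e)   = vtx₂ v

dag-g : (G : DiGraph) → DagElem G → DagElem G
dag-g G (vtx₁ u)     = vtx₂ u
dag-g G (vtx₂ u)     = vtx₂ u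
dag-g G (aE u v e)   = bE u v e
dag-g G (bE u v e)   = aE u v e

_† : DiGraph → UnaryAlg2
G † = record { Carrier = DagElem G ; f = dag-f G ; g = dag-g G }

module Submission where

-- A graph homomorphism G → H exists iff an algebra homomorphism G† → H†
-- exists.
--
-- (⇒) Every graph homomorphism φ lifts to the map φ† sending v₁ ↦ φ(v)₁,
--     v₂ ↦ φ(v)₂, a_(u,v) ↦ a_(φu,φv), b_(u,v) ↦ b_(φu,φv); it commutes with
--     f and g clause by clause.
-- (⇐) Given an algebra homomorphism ψ, the vertices of H† of the form w₁ are
--     exactly the fixed points of f, so ψ(u₁) = φ(u)₁ for a unique map φ,
--     and then ψ(u₂) = ψ(g u₁) = φ(u)₂.  An element x of H† with f x = p₁
--     and f (g x) = q₂ must be a_(p,q), hence witnesses the edge (p,q);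
--     x = ψ(a_(u,v)) has this property with p = φ u, q = φ v, so φ is a
--     graph homomorphism.

open import Defs
open import Data.Product using (_,_; proj₁; proj₂)
open import Function.Bundles using (_⇔_; mk⇔)
open import Data.Fin using (Fin)
open import Relation.Binary.PropositionalEquality
  using (_≡_; refl; sym; trans; cong; module ≡-Reasoning)

module _ {G H : DiGraph} where

  lift : GraphHom G H → DagElem G → DagElem H
  lift (φ , hom) (vtx₁ u)   = vtx₁ (φ u)
  lift (φ , hom) (vtx₂ u)   = vtx₂ (φ u)
  lift (φ , hom) (aE u v e) = aE (φ u) (φ v) (hom u v e)
  lift (φ , hom) (bE u v e) = bE (φ u) (φ v) (hom u v e)

  lift-isAlgHom : (φ : GraphHom G H) → IsAlgHom (G †) (H †) (lift φ)
  lift-isAlgHom φ = commutes-f , commutes-g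
    where
    commutes-f : ∀ x → lift φ (dag-f G x) ≡ dag-f H (lift φ x)
    commutes-f (vtx₁ u)   = refl
    commutes-f (vtx₂ u)   = refl
    commutes-f (aE u v e) = refl
    commutes-f (bE u v e) = refl

    commutes-g : ∀ x → lift φ (dag-g G x) ≡ dag-g H (lift φ x)
    commutes-g (vtx₁ u)   = refl
    commutes-g (vtx₂ u)   = refl
    commutes-g (aE u v e) = refl
    commutes-g (bE u v e) = refl

module _ {H : DiGraph} where

  vertexOf : DagElem H → Fin (n H)
  vertexOf (vtx₁ w)   = w
  vertexOf (vtx₂ w)   = w
  vertexOf (aE u v e) = u
  vertexOf (bE u v e) = u

  f-fixed : ∀ x → dag-f H x ≡ x → x ≡ vtx₁ (vertexOf x)
  f-fixed (vtx₁ w)   _  = refl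
  f-fixed (vtx₂ w)   ()
  f-fixed (aE u v e) ()
  f-fixed (bE u v e) ()

  edge-detect : ∀ x {p q} → dag-f H x ≡ vtx₁ p → dag-f H (dag-g H x) ≡ vtx₂ q →
                Edge H p q
  edge-detect (aE u v e) refl refl = e
  edge-detect (vtx₁ w)   _    ()
  edge-detect (vtx₂ w)   _    ()
  edge-detect (bE u v e) ()   _

module _ {G H : DiGraph} (ψ : AlgHom (G †) (H †)) where

  private
    ψ₀ : DagElem G → DagElem H
    ψ₀ = proj₁ ψ

    ψ-f : ∀ x → ψ₀ (dag-f G x) ≡ dag-f H (ψ₀ x)
    ψ-f = proj₁ (proj₂ ψ)

    ψ-g : ∀ x → ψ₀ (dag-g G x) ≡ dag-g H (ψ₀ x)
    ψ-g = proj₂ (proj₂ ψ)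

  restrict : Fin (n G) → Fin (n H)
  restrict u = vertexOf (ψ₀ (vtx₁ u))

  -- ψ(u₁) is f-fixed because u₁ is, hence of the form w₁.
  restrict-vtx₁ : ∀ u → ψ₀ (vtx₁ u) ≡ vtx₁ (restrict u)
  restrict-vtx₁ u = f-fixed (ψ₀ (vtx₁ u)) (sym (ψ-f (vtx₁ u)))

  restrict-vtx₂ : ∀ u → ψ₀ (vtx₂ u) ≡ vtx₂ (restrict u)
  restrict-vtx₂ u = trans (ψ-g (vtx₁ u)) (cong (dag-g H) (restrict-vtx₁ u))

  restrict-isGraphHom : IsGraphHom G H restrict
  restrict-isGraphHom u v e = edge-detect (ψ₀ a) tail head
    where
    open ≡-Reasoning

    a : DagElem G
    a = aE u v e

    tail : dag-f H (ψ₀ a) ≡ vtx₁ (restrict u)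
    tail = trans (sym (ψ-f a)) (restrict-vtx₁ u)

    head : dag-f H (dag-g H (ψ₀ a)) ≡ vtx₂ (restrict v)
    head = begin
      dag-f H (dag-g H (ψ₀ a)) ≡⟨ cong (dag-f H) (sym (ψ-g a)) ⟩
      dag-f H (ψ₀ (bE u v e))  ≡⟨ sym (ψ-f (bE u v e)) ⟩
      ψ₀ (vtx₂ v)              ≡⟨ restrict-vtx₂ v ⟩
      vtx₂ (restrict v)        ∎

mainTheorem2 : (G H : DiGraph) →
    LoopFree G → Connected G → AtLeastTwoVertices G →
    LoopFree H → Connected H → AtLeastTwoVertices H →
    GraphHom G H ⇔ AlgHom (G †) (H †)
mainTheorem2 G H _ _ _ _ _ _ = mk⇔
  (λ φ → lift φ , lift-isAlgHom φ)
  (λ ψ → restrict ψ , restrict-isGraphHom ψ)
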